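{- Let $\mathcal{M}=(S,I,\to,\Pi,\langle\!\langle\cdot\rangle\!\rangle)$ be a labelled transition system with $k$-bounded branching, and let $\sigma_1,\dots,\sigma_k\colon S\to S$ be functions such that $\to\;=\;\bigcup_{i=1}^k \sigma_i$, i.e. for all $s,t\in S$, $s\to t$ iff $t=\sigma_i(s)$ for some $1\le i\le k$. Let $\simeq$ be a label-preserving partition on $\mathcal{M}$. Suppose there exists a function $r\colon S\times S\to\mathbb{N}$ such that, for every $s,t\in S$ with $s\simeq t$, $$\bigwedge_{i=1}^k\Big(\bigvee_{j=1}^k \sigma_i(s)\simeq\sigma_j(t)\;\lor\; \big(s\simeq\sigma_i(s)\land r(\sigma_i(s),\sigma_i(s))<r(s,s)\big)\;\lor\;\bigvee_{j=1}^k\big(t\simeq\sigma_j(t)\land r(\sigma_i(s),\sigma_j(t))<r(\sigma_i(s),t)\big)\Big).$$ Then $\simeq$ is a stutter-insensitive bisimulation on $\mathcal{M}$.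
   Context: A labelled transition system $\mathcal{M}$ consists of a countable state space $S$, an initial region $I\subseteq S$, a transition relation $\to\subseteq S\times S$, a set of atomic propositions $\Pi$, and a labelling function $\langle\!\langle\cdot\rangle\!\rangle\colon S\to\mathcal{P}(\Pi)$. It has $k$-bounded branching ($k\in\mathbb{N}$) if every state $s$ satisfies $0<|\{t\in S: s\to t\}|\le k$. A path is an infinite sequence $s_0s_1\dots$ with $s_i\to s_{i+1}$ for all $i$; $\mathrm{Paths}(s)$ denotes the set of paths with $s_0=s$. A partition on $\mathcal{M}$ is an equivalence relation $\simeq$ on $S$; it is label-preserving if $s\simeq t$ implies $\langle\!\langle s\rangle\!\rangle=\langle\!\langle t\rangle\!\rangle$. A label-preserving partition $\simeq$ is a stutter-insensitive bisimulation if for all $s,s'\in S$ with $s\simeq s'$ and every $\pi\in\mathrm{Paths}(s)$ there exists $\pi'\in\mathrm{Paths}(s')$ such that $\pi$ and $\pi'$ can be split into equally many (consecutive) non-empty finite subsequences $\pi=B_1B_2\dots$ and $\pi'=B_1'B_2'\dots$ with $t\simeq t'$ for all $i$ and all $t\in B_i$, $t'\in B_i'$. -}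

module Defs where

open import Data.Nat using (ℕ; suc; _≤_; _<_)
open import Data.Fin using (Fin)
open import Data.Product using (Σ; ∃; _×_; _,_)
open import Function.Bundles using (_↣_; _⇔_)
open import Relation.Binary.PropositionalEquality using (_≡_)
open import Relation.Binary.Structures using (IsEquivalence)

record LTS : Set₁ where
  field
    S         : Set
    countable : S ↣ ℕ
    I         : S → Set
    _⟶_       : S → S → Set
    Π         : Set
    ⟪_⟫       : S → Π → Set

module _ (M : LTS) where
  open LTS M

  BoundedBranching : ℕ → Set
  BoundedBranching k = ∀ s →
    (∃ λ t → s ⟶ t) ×
    (Σ (Fin k → S) λ f → ∀ t → s ⟶ t → ∃ λ i → t ≡ f i)

  record Path (s : S) : Set where
    field
      seq   : ℕ → S
      start : seq 0 ≡ s
      step  : ∀ n → seq n ⟶ seq (suc n)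

  record Partition : Set₁ where
    field
      _≃_   : S → S → Set
      isEquivalence : IsEquivalence _≃_

  LabelPreserving : Partition → Set
  LabelPreserving P = ∀ s t → s ≃ t → ∀ p → (⟪ s ⟫ p ⇔ ⟪ t ⟫ p)
    where open Partition P

  record Splitting : Set where
    field
      b     : ℕ → ℕ
      b0    : b 0 ≡ 0
      b-inc : ∀ i → b i < b (suc i)

  open Splitting

  InBlock : Splitting → ℕ → ℕ → Set
  InBlock B i m = b B i ≤ m × m < b B (suc i)

  StutterMatch : Partition → (ℕ → S) → (ℕ → S) → Set
  StutterMatch P π π' = Σ Splitting λ B → Σ Splitting λ B' →
    ∀ i m n → InBlock B i m → InBlock B' i n → π m ≃ π' n
    where open Partition P

  StutterBisimulation : Partition → Set
  StutterBisimulation P = LabelPreserving P ×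
    (∀ s s' → s ≃ s' → (π : Path s) →
       Σ (Path s') λ π' → StutterMatch P (Path.seq π) (Path.seq π'))
    where open Partition P

{-# OPTIONS --safe #-}
-- Given π from s and s ≃ s', build π' from s' greedily while tracking a
-- position m of π with π m ≃ t for the current state t of π'.  The hypothesis
-- at π m ≃ t, instantiated at the step π m ⟶ π (1 + m), lets both paths move,
-- or lets π stutter while r (π m) (π m) decreases, or lets π' stutter while
-- r (π (1 + m)) t decreases.  Runs of stutters of π are finite by the first
-- measure and are absorbed into a single move of π'; runs of stutters of π'
-- are finite by the second, since m stays fixed along them.  So π advances
-- infinitely often, and each run of stutters of π' together with the
-- following advance of π forms a pair of matching blocks.
module Submission where

open import Defs
open import Data.Nat using (ℕ; zero; suc; _≤_; _<_; s≤s)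
open import Data.Nat.Properties using (≤-refl; <⇒≤; <⇒≱; m≤n⇒m<n∨m≡n)
open import Data.Nat.Induction using (<-wellFounded)
open import Induction.WellFounded using (Acc; acc)
open import Data.Fin using (Fin)
open import Data.Product using (Σ; ∃; _×_; _,_; proj₁; proj₂)
open import Data.Empty using (⊥-elim)
open import Data.Sum using (_⊎_; inj₁; inj₂)
open import Function.Base using (_∘_)
open import Function.Bundles using (_⇔_; Equivalence)
open import Relation.Binary.PropositionalEquality using (_≡_; refl; sym; trans; subst)
open import Relation.Binary.Structures using (IsEquivalence)

module StutterSchedule {M : LTS} (P : Partition M) where
  open LTS M
  open Partition P
  open IsEquivalence isEquivalence renaming (refl to ≃-refl; sym to ≃-sym; trans to ≃-trans)

  Constant : (ℕ → S) → S → ℕ → ℕ → Set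
  Constant π t m m' = ∀ x → m ≤ x → x < m' → π x ≃ t

  Advance : (ℕ → S) → ℕ → ℕ → S → Set
  Advance π m m' t = m < m' × Constant π t m m'

  Stutter : ℕ → ℕ → S → S → ℕ → ℕ → Set
  Stutter m m' t t' μ μ' = m' ≡ m × t ≃ t' × μ' < μ

  Progress : (ℕ → S) → ℕ → ℕ → S → S → ℕ → ℕ → Set
  Progress π m m' t t' μ μ' = Advance π m m' t ⊎ Stutter m m' t t' μ μ'

  constant-empty : ∀ {π t m} → Constant π t m m
  constant-empty x m≤x x<m = ⊥-elim (<⇒≱ x<m m≤x)

  constant-cons : ∀ {π t m m'} → π m ≃ t → Constant π t (suc m) m' → Constant π t m m'
  constant-cons πm≃t c x m≤x x<m' with m≤n⇒m<n∨m≡n m≤x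
  ... | inj₁ m<x  = c x m<x x<m'
  ... | inj₂ refl = πm≃t

  advance-cons : ∀ {π t m m'} → π m ≃ t → suc m ≤ m' × Constant π t (suc m) m' →
                 Advance π m m' t
  advance-cons πm≃t (m<m' , c) = m<m' , constant-cons πm≃t c

  progress⇒constant : ∀ {π m m' t t' μ μ'} → Progress π m m' t t' μ μ' →
                      m ≤ m' × Constant π t m m'
  progress⇒constant (inj₁ (m<m' , c)) = <⇒≤ m<m' , c
  progress⇒constant (inj₂ (refl , _)) = ≤-refl , constant-empty

  module _ (π π' : ℕ → S) (pos μ : ℕ → ℕ) (pos-zero : pos 0 ≡ 0)
           (progress : ∀ n → Progress π (pos n) (pos (suc n)) (π' n) (π' (suc n)) (μ n) (μ (suc n)))
           where

    record NextAdvance (n : ℕ) : Set where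
      field
        N        : ℕ
        n≤N      : n ≤ N
        same-pos : pos N ≡ pos n
        stutters : Constant π' (π' N) n (suc N)
        advance  : Advance π (pos N) (pos (suc N)) (π' N)

    nextAdvance-acc : ∀ n → Acc _<_ (μ n) → NextAdvance n
    nextAdvance-acc n (acc rec) with progress n
    ... | inj₁ adv = record
      { N = n ; n≤N = ≤-refl ; same-pos = refl
      ; stutters = constant-cons ≃-refl constant-empty ; advance = adv }
    ... | inj₂ (pos≡ , π'n≃ , μ<) = record
      { N = N ; n≤N = <⇒≤ n≤N ; same-pos = trans same-pos pos≡
      ; stutters = constant-cons (≃-trans π'n≃ (stutters (suc n) ≤-refl (s≤s n≤N))) stutters
      ; advance = advance }
      where open NextAdvance (nextAdvance-acc (suc n) (rec μ<))

    nextAdvance : ∀ n → NextAdvance n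
    nextAdvance n = nextAdvance-acc n (<-wellFounded (μ n))

    boundary : ℕ → ℕ
    boundary zero    = 0
    boundary (suc i) = suc (NextAdvance.N (nextAdvance (boundary i)))

    stutterMatch : StutterMatch M P π π'
    stutterMatch = blocks , blocks' , match
      where
      blocks' : Splitting M
      blocks' = record
        { b = boundary ; b0 = refl
        ; b-inc = λ i → s≤s (NextAdvance.n≤N (nextAdvance (boundary i))) }

      blocks : Splitting M
      blocks = record
        { b = λ i → pos (boundary i) ; b0 = pos-zero
        ; b-inc = λ i → let open NextAdvance (nextAdvance (boundary i))
                        in subst (_< pos (suc N)) same-pos (proj₁ advance) }

      match : ∀ i x y → InBlock M blocks i x → InBlock M blocks' i y → π x ≃ π' y
      match i x y (pos≤x , x<) (b≤y , y<) =
        ≃-trans (proj₂ advance x (subst (_≤ x) (sym same-pos) pos≤x) x<)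
                (≃-sym (stutters y b≤y y<))
        where open NextAdvance (nextAdvance (boundary i))

module StutterMatching {M : LTS} {k : ℕ} (σ : Fin k → LTS.S M → LTS.S M)
    (hσ : ∀ s t → (LTS._⟶_ M s t ⇔ (∃ λ i → t ≡ σ i s)))
    (P : Partition M) (r : LTS.S M → LTS.S M → ℕ)
    (H : ∀ s t → Partition._≃_ P s t → ∀ i →
       (∃ λ j → Partition._≃_ P (σ i s) (σ j t))
       ⊎ (Partition._≃_ P s (σ i s) × r (σ i s) (σ i s) < r s s)
       ⊎ (∃ λ j → Partition._≃_ P t (σ j t) × r (σ i s) (σ j t) < r (σ i s) t))
    where
  open LTS M
  open Partition P
  open IsEquivalence isEquivalence using () renaming (sym to ≃-sym; trans to ≃-trans)
  open StutterSchedule P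

  σ-step : ∀ i t → t ⟶ σ i t
  σ-step i t = Equivalence.from (hσ t (σ i t)) (i , refl)

  module _ {s s' : S} (s≃s' : s ≃ s') (p : Path M s) where
    open Path p renaming (seq to π)

    condition-along-step : ∀ m t → π m ≃ t →
        (∃ λ j → π (suc m) ≃ σ j t)
      ⊎ (π m ≃ π (suc m) × r (π (suc m)) (π (suc m)) < r (π m) (π m))
      ⊎ (∃ λ j → t ≃ σ j t × r (π (suc m)) (σ j t) < r (π (suc m)) t)
    condition-along-step m t πm≃t with Equivalence.to (hσ _ _) (step m)
    ... | i , π[1+m]≡σᵢπm rewrite π[1+m]≡σᵢπm = H (π m) t πm≃t i

    record Move (m : ℕ) (t : S) : Set where
      field
        m'      : ℕ
        t'      : S
        t⟶t'    : t ⟶ t'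
        matched : π m' ≃ t'
        kind    : Progress π m m' t t' (r (π (suc m)) t) (r (π (suc m')) t')

    move-acc : ∀ m t → π m ≃ t → Acc _<_ (r (π m) (π m)) → Move m t
    move-acc m t πm≃t (acc rec) with condition-along-step m t πm≃t
    ... | inj₁ (j , π[1+m]≃σⱼt) = record
      { m' = suc m ; t' = σ j t ; t⟶t' = σ-step j t ; matched = π[1+m]≃σⱼt
      ; kind = inj₁ (advance-cons πm≃t (≤-refl , constant-empty)) }
    ... | inj₂ (inj₁ (πm≃π[1+m] , r<)) = record
      { m' = m' ; t' = t' ; t⟶t' = t⟶t' ; matched = matched
      ; kind = inj₁ (advance-cons πm≃t (progress⇒constant kind)) }
      where open Move (move-acc (suc m) t (≃-trans (≃-sym πm≃π[1+m]) πm≃t) (rec r<))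
    ... | inj₂ (inj₂ (j , t≃σⱼt , r<)) = record
      { m' = m ; t' = σ j t ; t⟶t' = σ-step j t ; matched = ≃-trans πm≃t t≃σⱼt
      ; kind = inj₂ (refl , t≃σⱼt , r<) }

    record Config : Set where
      field
        pos     : ℕ
        state   : S
        matched : π pos ≃ state
    open Config using (pos; state)

    move : (c : Config) → Move (pos c) (state c)
    move c = move-acc (pos c) (state c) (Config.matched c) (<-wellFounded _)

    next : Config → Config
    next c = record { pos = m' ; state = t' ; matched = matched }
      where open Move (move c)

    configs : ℕ → Config
    configs zero    = record { pos = 0 ; state = s' ; matched = subst (_≃ s') (sym start) s≃s' }
    configs (suc n) = next (configs n)

    matchingPath : Σ (Path M s') λ π' → StutterMatch M P π (Path.seq π')
    matchingPath = π' , stutterMatch π (Path.seq π') (pos ∘ configs) μ refl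
                                     (λ n → Move.kind (move (configs n)))
      where
      π' : Path M s'
      π' = record { seq = state ∘ configs ; start = refl
                  ; step = λ n → Move.t⟶t' (move (configs n)) }

      μ : ℕ → ℕ
      μ n = r (π (suc (pos (configs n)))) (state (configs n))

theorem3 : (M : LTS) (k : ℕ) → BoundedBranching M k →
    (σ : Fin k → LTS.S M → LTS.S M) →
    (∀ s t → (LTS._⟶_ M s t ⇔ (∃ λ i → t ≡ σ i s))) →
    (P : Partition M) → LabelPreserving M P →
    (r : LTS.S M → LTS.S M → ℕ) →
    (∀ s t → Partition._≃_ P s t → ∀ i →
       (∃ λ j → Partition._≃_ P (σ i s) (σ j t))
       ⊎ (Partition._≃_ P s (σ i s) × r (σ i s) (σ i s) < r s s)
       ⊎ (∃ λ j → Partition._≃_ P t (σ j t) × r (σ i s) (σ j t) < r (σ i s) t)) →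
    StutterBisimulation M P
-- k-bounded branching already follows from the decomposition of ⟶ by σ.
theorem3 _ _ _ σ hσ P lp r H = lp , λ s s' → StutterMatching.matchingPath σ hσ P r H
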